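{- For every $n\ge1$ and every unlabeled binary tree $T\in\mathrm{URL}_n$, there exists a bijection between $\mathrm{RS}(T)$ and $\mathrm{And}^{II}(T)$.
   Context: The map $\Psi$ sends a word $\pi$ of distinct integers to a labeled binary tree: empty word to empty tree; otherwise, with $i$ the least letter and $\pi=\sigma i\tau$, the tree has root $i$, left subtree $\Psi(\sigma)$, right subtree $\Psi(\tau)$. The tree shape of $\sigma$ is the underlying unlabeled binary tree of $\Psi(\sigma)$. $\mathrm{URL}_n$ is the set of unlabeled rooted binary trees with $n$ vertices in which no vertex has a left child but no right child. André II permutations: the empty word and one-letter words are André II; a word $\sigma$ of length $\ge2$ with $\sigma=\tau\,\min(\sigma)\,\tau'$ is André II if $\tau,\tau'$ are André II and the minimum letter of $\tau\tau'$ lies in $\tau'$. A permutation $\sigma$ of $[n]$ is simsun if $\sigma_n=n$ and for each $k=0,\dots,n-1$ the word obtained by deleting the letters $n,n-1,\dots,n-k+1$ has no double descent (index $i$ with $\sigma_i>\sigma_{i+1}>\sigma_{i+2}$). $\mathrm{RS}(T)$ and $\mathrm{And}^{II}(T)$ are the sets of simsun, respectively André II, permutations of $[n]$ with tree shape $T$. -}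

module Defs where

open import Data.Nat using (ℕ; zero; suc; _+_; _<_; _≤_; _>_)
open import Data.List using (List; []; _∷_; _++_; [_]; filter; applyUpTo; last)
open import Data.List.Relation.Unary.All using (All)
open import Data.List.Relation.Unary.Any using (Any)
open import Data.List.Relation.Binary.Permutation.Propositional using (_↭_)
open import Data.Maybe using (just)
open import Data.Product using (_×_)
open import Data.Unit using (⊤)
open import Data.Empty using (⊥)
open import Relation.Nullary using (¬_)
open import Relation.Binary.PropositionalEquality using (_≡_)
open import Data.Nat.Properties using (_≤?_)

Word : Set
Word = List ℕ

data BTree : Set where
  leaf : BTree
  node : BTree → BTree → BTree

size : BTree → ℕ
size leaf       = 0
size (node l r) = suc (size l + size r)

-- No vertex has a left child but no right child.
NoLeftOnly : BTree → Set
NoLeftOnly leaf                              = ⊤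
NoLeftOnly (node leaf r)                     = NoLeftOnly r
NoLeftOnly (node (node a b) leaf)            = ⊥
NoLeftOnly (node (node a b) (node c d))      = NoLeftOnly (node a b) × NoLeftOnly (node c d)

URL : ℕ → BTree → Set
URL n T = size T ≡ n × NoLeftOnly T

-- The tree shape of a word (underlying unlabeled tree of Ψ(σ)), as a relation:
-- the root is the least letter i of σ = σ₁ i σ₂, left subtree from σ₁, right from σ₂.
data HasShape : Word → BTree → Set where
  shape-[] : HasShape [] leaf
  shape-node : ∀ {σ₁ σ₂ i L R} →
    All (i <_) σ₁ → All (i <_) σ₂ →
    HasShape σ₁ L → HasShape σ₂ R →
    HasShape (σ₁ ++ i ∷ σ₂) (node L R)

data AndreII : Word → Set where
  andre-[] : AndreII []
  andre-single : ∀ x → AndreII [ x ]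
  andre-split : ∀ {τ τ′ m} →
    All (m <_) τ → All (m <_) τ′ →
    AndreII τ → AndreII τ′ →
    -- the minimum letter of τ τ′ lies in τ′ (this also forces length ≥ 2)
    Any (λ y → All (y ≤_) τ × All (y ≤_) τ′) τ′ →
    AndreII (τ ++ m ∷ τ′)

IsPerm : ℕ → Word → Set
IsPerm n σ = σ ↭ applyUpTo suc n

NoDoubleDescent : Word → Set
NoDoubleDescent (a ∷ b ∷ c ∷ rest) = ¬ (a > b × b > c) × NoDoubleDescent (b ∷ c ∷ rest)
NoDoubleDescent _ = ⊤

restrict : ℕ → Word → Word
restrict j σ = filter (_≤? j) σ

-- simsun permutation of [n]: σ_n = n and for each k = 0..n-1, deleting
-- n, n-1, …, n-k+1 (i.e. keeping letters ≤ n-k) leaves no double descent.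
Simsun : ℕ → Word → Set
Simsun n σ = IsPerm n σ × last σ ≡ just n ×
  (∀ k → k < n → NoDoubleDescent (restrict (n Data.Nat.∸ k) σ))

AndreIIPerm : ℕ → Word → Set
AndreIIPerm n σ = IsPerm n σ × AndreII σ

-- Subset type whose equality only depends on the element (proof is irrelevant).
record Sub (A : Set) (P : A → Set) : Set where
  constructor _,_
  field
    elem : A
    .proof : P elem

RS : ℕ → BTree → Set
RS n T = Sub Word (λ σ → Simsun n σ × HasShape σ T)

AndII : ℕ → BTree → Set
AndII n T = Sub Word (λ σ → AndreIIPerm n σ × HasShape σ T)

{-# OPTIONS --safe #-}
module Submission where

open import Defs
open import Data.Nat using (ℕ; _≥_)
open import Function.Bundles using (_⤖_)
open import Data.Empty using (⊥-elim)
open import Data.List using (List; []; _∷_; _++_; _∷ʳ_; [_]; map; applyUpTo; last; initLast; _∷ʳ′_)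
open import Data.List.Membership.Propositional using (_∈_; lose; find)
open import Data.List.Membership.Propositional.Properties using (∈-++⁺ʳ; ∈-map⁺)
open import Data.List.Properties using (++-assoc; ++-conicalʳ; ∷-injective; ∷-injectiveʳ; ∷ʳ-injective)
open import Data.List.Properties using (≡-dec)
open import Data.List.Properties using (map-++; map-∘; map-id; map-id-local; map-applyUpTo; applyUpTo-∷ʳ)
open import Data.List.Properties using (filter-++; filter-all; filter-none; filter-accept; filter-reject)
open import Data.List.Relation.Binary.Permutation.Propositional using (_↭_; ↭-refl; ↭-sym; ↭-trans)
open import Data.List.Relation.Binary.Permutation.Propositional using (↭-prep; ↭-swap; ↭⇒↭ₛ)
open import Data.List.Relation.Binary.Permutation.Propositional.Properties using (All-resp-↭; ∈-resp-↭)
open import Data.List.Relation.Binary.Permutation.Propositional.Properties using (drop-∷; ∷↭∷ʳ)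
open import Data.List.Relation.Binary.Permutation.Propositional.Properties using (++⁺ʳ; map⁺; ↭-empty-inv)
import Data.List.Relation.Binary.Permutation.Setoid.Properties as PermutationSetoid
open import Data.List.Relation.Unary.All as All using (All; []; _∷_; all?)
import Data.List.Relation.Unary.All.Properties as All
open import Data.List.Relation.Unary.AllPairs using (AllPairs; []; _∷_)
open import Data.List.Relation.Unary.Any as Any using (Any; here; there)
import Data.List.Relation.Unary.Any.Properties as Any
open import Data.List.Relation.Unary.Unique.Propositional using (Unique)
import Data.List.Relation.Unary.Unique.Propositional.Properties as Unique
open import Data.Maybe using (Maybe; just; nothing)
open import Data.Nat using (zero; suc; pred; >-nonZero; _<_; _≤_; _∸_; s≤s; z<s; s<s; _<?_; _≤?_)
open import Data.Nat.Properties
open import Data.Product using (_×_; _,_; proj₁; proj₂; ∃)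
open import Data.Sum using (_⊎_; inj₁; inj₂)
open import Data.Unit using (⊤; tt)
open import Function.Base using (_∘_)
open import Function.Bundles using (_↔_; mk↔ₛ′)
open import Function.Properties.Inverse using (↔-trans; ↔⇒⤖)
open import Relation.Binary.Definitions using (DecidableEquality)
open import Relation.Binary.PropositionalEquality using (_≡_; _≢_; ≢-sym; setoid)
open import Relation.Binary.PropositionalEquality using (refl; sym; trans; cong; subst; subst₂)
open import Relation.Nullary using (¬_; yes; no)
open import Relation.Nullary.Decidable.Core using (recompute)

-- Cut a word at its right-to-left minima, u = w₀ s₀ w₁ s₁ ⋯ wₖ sₖ: the sᵢ label the right
-- spine of Ψ(u) and the wᵢ are the left subtrees hanging from it. Call u an André spine when
-- every block wᵢ is André II. A simsun permutation of [n] is σ = u n with u an André spine: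
-- deleting large letters preserves the block structure, and a block violating the André
-- condition would, after deleting the letters above its least letter α, leave a double descent
-- α > m > z. An André II permutation of [n] is τ = pushSpine 1 o for a unique André spine o on
-- {2,…,n}, where pushSpine puts the new minimum at the root of the spine and moves every spine
-- label one vertex down. In both cases u (resp. o) has the shape of T with its last spine vertex
-- removed, so shifting letters by one matches the two families.

All-++∷⁻ : ∀ {A : Set} {P : A → Set} xs {m ys} → All P (xs ++ m ∷ ys) → All P xs × P m × All P ys
All-++∷⁻ xs p with All.++⁻ xs p
... | pxs , pm ∷ pys = pxs , pm , pys

AllPairs-++⁻ : ∀ {A : Set} {R : A → A → Set} xs {ys} → AllPairs R (xs ++ ys) →
               All (λ x → All (R x) ys) xs × AllPairs R ys
AllPairs-++⁻ []       rs        = [] , rs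
AllPairs-++⁻ (x ∷ xs) (rx ∷ rs) with AllPairs-++⁻ xs rs
... | rxs , rys = All.++⁻ʳ xs rx ∷ rxs , rys

Unique-resp-↭ : ∀ {xs ys : Word} → xs ↭ ys → Unique xs → Unique ys
Unique-resp-↭ p = PermutationSetoid.Unique-resp-↭ (setoid ℕ) (↭⇒↭ₛ p)

∷ʳ-cancel-↭ : ∀ {xs ys : Word} x → xs ∷ʳ x ↭ ys ∷ʳ x → xs ↭ ys
∷ʳ-cancel-↭ {xs} {ys} x p = drop-∷ (↭-trans (∷↭∷ʳ x xs) (↭-trans p (↭-sym (∷↭∷ʳ x ys))))

min≤-++∷ : ∀ w {m ρ} → All (m <_) w → All (m <_) ρ → All (m ≤_) (w ++ m ∷ ρ)
min≤-++∷ w m<w m<ρ = All.++⁺ (All.map <⇒≤ m<w) (≤-refl ∷ All.map <⇒≤ m<ρ)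

↭-min-unique : ∀ w {m ρ c ℓ} → w ++ m ∷ ρ ↭ c ∷ ℓ → All (m <_) w → All (m <_) ρ → All (c <_) ℓ → m ≡ c
↭-min-unique w p m<w m<ρ c<ℓ = ≤-antisym
  (All.lookup (min≤-++∷ w m<w m<ρ) (∈-resp-↭ (↭-sym p) (here refl)))
  (All.head (All.++⁻ʳ w (All-resp-↭ (↭-sym p) (≤-refl ∷ All.map <⇒≤ c<ℓ))))

min-split-unique : ∀ xs xs′ {m m′ ys ys′} → xs ++ m ∷ ys ≡ xs′ ++ m′ ∷ ys′ →
                   All (m <_) xs → All (m <_) ys → All (m′ <_) xs′ → All (m′ <_) ys′ →
                   xs ≡ xs′ × ys ≡ ys′
min-split-unique []       []        eq _ _ _ _ = refl , ∷-injectiveʳ eq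
min-split-unique []       (_ ∷ xs′) eq _ m<ys (m′<x′ ∷ _) _
  with refl , eq′ ← ∷-injective eq
  = ⊥-elim (<-asym m′<x′ (All.head (All.++⁻ʳ xs′ (subst (All _) eq′ m<ys))))
min-split-unique (_ ∷ xs) []        eq (m<x ∷ _) _ _ m′<ys′
  with refl , eq′ ← ∷-injective eq
  = ⊥-elim (<-asym m<x (All.head (All.++⁻ʳ xs (subst (All _) (sym eq′) m′<ys′))))
min-split-unique (_ ∷ xs) (_ ∷ xs′) eq (_ ∷ m<xs) m<ys (_ ∷ m′<xs′) m′<ys′
  with refl , eq′ ← ∷-injective eq
  with refl , refl ← min-split-unique xs xs′ eq′ m<xs m<ys m′<xs′ m′<ys′ = refl , refl

dropLast : ∀ {A : Set} → List A → List A
dropLast []           = []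
dropLast (x ∷ [])     = []
dropLast (x ∷ y ∷ xs) = x ∷ dropLast (y ∷ xs)

dropLast-∷ʳ : ∀ {A : Set} (xs : List A) x → dropLast (xs ∷ʳ x) ≡ xs
dropLast-∷ʳ []           x = refl
dropLast-∷ʳ (y ∷ [])     x = refl
dropLast-∷ʳ (y ∷ z ∷ xs) x = cong (y ∷_) (dropLast-∷ʳ (z ∷ xs) x)

last-∷ʳ : ∀ {A : Set} (xs : List A) x → last (xs ∷ʳ x) ≡ just x
last-∷ʳ []           x = refl
last-∷ʳ (y ∷ [])     x = refl
last-∷ʳ (y ∷ z ∷ xs) x = last-∷ʳ (z ∷ xs) x

dropLast-∷ʳ-last : ∀ {A : Set} (xs : List A) {x} → last xs ≡ just x → dropLast xs ∷ʳ x ≡ xs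
dropLast-∷ʳ-last (y ∷ [])     refl = refl
dropLast-∷ʳ-last (y ∷ z ∷ xs) eq   = cong (y ∷_) (dropLast-∷ʳ-last (z ∷ xs) eq)

word-≟ : DecidableEquality Word
word-≟ = ≡-dec _≟_

Sub-≡ : ∀ {A : Set} {P : A → Set} {a b : Sub A P} → Sub.elem a ≡ Sub.elem b → a ≡ b
Sub-≡ {a = x , _} {b = .x , _} refl = refl

-- The proofs inside `Sub` are irrelevant, so the inverse laws are rebuilt with `recompute`.
Sub-↔ : ∀ {A B : Set} {P : A → Set} {Q : B → Set} → DecidableEquality A → DecidableEquality B →
        (f : A → B) (g : B → A) → (∀ {x} → P x → Q (f x)) → (∀ {y} → Q y → P (g y)) →
        (∀ {x} → P x → g (f x) ≡ x) → (∀ {y} → Q y → f (g y) ≡ y) → Sub A P ↔ Sub B Q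
Sub-↔ _≟A_ _≟B_ f g f-resp g-resp g∘f f∘g = mk↔ₛ′ to from to∘from from∘to
  where
  to : Sub _ _ → Sub _ _
  to (x , p) = f x , f-resp p
  from : Sub _ _ → Sub _ _
  from (y , q) = g y , g-resp q
  to∘from : ∀ y → to (from y) ≡ y
  to∘from (y , q) = Sub-≡ (recompute (f (g y) ≟B y) (f∘g q))
  from∘to : ∀ x → from (to x) ≡ x
  from∘to (x , p) = Sub-≡ (recompute (g (f x) ≟A x) (g∘f p))

growSpine : BTree → BTree
growSpine leaf       = node leaf leaf
growSpine (node L R) = node L (growSpine R)

HasPrunedShape : Word → BTree → Set
HasPrunedShape u T = ∃ λ T′ → T ≡ growSpine T′ × HasShape u T′

HasShape-[]⁻ : ∀ {σ T} → HasShape σ T → σ ≡ [] → T ≡ leaf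
HasShape-[]⁻ shape-[]                    _  = refl
HasShape-[]⁻ (shape-node {[]}    _ _ _ _) ()
HasShape-[]⁻ (shape-node {_ ∷ _} _ _ _ _) ()

HasShape-∷ʳ : ∀ {u T x} → HasShape u T → All (_< x) u → HasShape (u ∷ʳ x) (growSpine T)
HasShape-∷ʳ shape-[] _ = shape-node [] [] shape-[] shape-[]
HasShape-∷ʳ {x = x} (shape-node {w} {ρ} {m} m<w m<ρ sw sρ) u<x with _ , m<x , ρ<x ← All-++∷⁻ w u<x =
  subst (λ σ → HasShape σ _) (sym (++-assoc w (m ∷ ρ) [ x ]))
        (shape-node m<w (All.∷ʳ⁺ m<ρ m<x) sw (HasShape-∷ʳ sρ ρ<x))

HasShape-∷ʳ⁻ : ∀ {σ T u x} → HasShape σ T → σ ≡ u ∷ʳ x → All (_< x) u → HasPrunedShape u T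
HasShape-∷ʳ⁻ {u = u} shape-[] eq _ with () ← ++-conicalʳ u _ (sym eq)
HasShape-∷ʳ⁻ (shape-node {σ₁} {σ₂} {i} i<σ₁ i<σ₂ s₁ s₂) eq u<x with initLast σ₂
... | [] with refl , refl ← ∷ʳ-injective σ₁ _ eq with σ₁ | i<σ₁ | u<x
...   | []    | _       | _       rewrite HasShape-[]⁻ s₁ refl | HasShape-[]⁻ s₂ refl =
  leaf , refl , shape-[]
...   | _ ∷ _ | i<y ∷ _ | y<i ∷ _ = ⊥-elim (<-asym i<y y<i)
HasShape-∷ʳ⁻ (shape-node {σ₁} {_} {i} i<σ₁ i<σ₂ s₁ s₂) eq u<x | σ₂′ ∷ʳ′ y
  with refl , refl ← ∷ʳ-injective (σ₁ ++ i ∷ σ₂′) _ (trans (++-assoc σ₁ (i ∷ σ₂′) [ y ]) eq)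
  with R′ , refl , sR′ ← HasShape-∷ʳ⁻ s₂ refl (All.tail (All.++⁻ʳ σ₁ u<x)) =
  node _ R′ , refl , shape-node i<σ₁ (All.++⁻ˡ σ₂′ i<σ₂) s₁ sR′

pushSpine : ℕ → Word → Word
pushSpine c []       = [ c ]
pushSpine c (x ∷ xs) with all? (x <?_) xs
... | yes _ = c ∷ pushSpine x xs
... | no  _ = x ∷ pushSpine c xs

popSpine : Word → Word × Maybe ℕ
popSpine []       = [] , nothing
popSpine (x ∷ xs) with popSpine xs | all? (x <?_) xs
... | _ , nothing | _     = [] , just x
... | o , just s  | yes _ = s ∷ o , just x
... | o , just s  | no  _ = x ∷ o , just s

pushSpine-↭ : ∀ c xs → pushSpine c xs ↭ c ∷ xs
pushSpine-↭ c []       = ↭-refl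
pushSpine-↭ c (x ∷ xs) with all? (x <?_) xs
... | yes _ = ↭-prep c (pushSpine-↭ x xs)
... | no  _ = ↭-trans (↭-prep x (pushSpine-↭ c xs)) (↭-swap x c ↭-refl)

All-pushSpine : ∀ {P : ℕ → Set} {c xs} → P c → All P xs → All P (pushSpine c xs)
All-pushSpine {c = c} {xs} pc pxs = All-resp-↭ (↭-sym (pushSpine-↭ c xs)) (pc ∷ pxs)

∈-pushSpine : ∀ c xs → c ∈ pushSpine c xs
∈-pushSpine c xs = ∈-resp-↭ (↭-sym (pushSpine-↭ c xs)) (here refl)

pushSpine-++ : ∀ c w {m ρ} → All (m <_) w → All (m <_) ρ →
               pushSpine c (w ++ m ∷ ρ) ≡ w ++ c ∷ pushSpine m ρ
pushSpine-++ c []      {m} {ρ} _ m<ρ with all? (m <?_) ρ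
... | yes _     = refl
... | no  m≮ρ   = ⊥-elim (m≮ρ m<ρ)
pushSpine-++ c (x ∷ w) {m} {ρ} (m<x ∷ m<w) m<ρ with all? (x <?_) (w ++ m ∷ ρ)
... | yes x<wmρ = ⊥-elim (<-asym m<x (All.head (All.++⁻ʳ w x<wmρ)))
... | no  _     = cong (x ∷_) (pushSpine-++ c w m<w m<ρ)

popSpine-pushSpine : ∀ c u → All (c <_) u → popSpine (pushSpine c u) ≡ (u , just c)
popSpine-pushSpine c []       _            = refl
popSpine-pushSpine c (x ∷ xs) (c<x ∷ c<xs) with all? (x <?_) xs
... | yes x<xs rewrite popSpine-pushSpine x xs x<xs with all? (c <?_) (pushSpine x xs)
...   | yes _    = refl
...   | no  c≮xs = ⊥-elim (c≮xs (All-pushSpine c<x c<xs))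
popSpine-pushSpine c (x ∷ xs) (c<x ∷ c<xs) | no _
  rewrite popSpine-pushSpine c xs c<xs with all? (x <?_) (pushSpine c xs)
...   | yes x<xs = ⊥-elim (<-asym c<x (All.lookup x<xs (∈-pushSpine c xs)))
...   | no  _    = refl

MinInRight : Word → Word → Set
MinInRight τ τ′ = Any (λ y → All (y ≤_) τ × All (y ≤_) τ′) τ′

MinInRight⇒<-left : ∀ {w ρ m} → MinInRight w ρ → All (m ≤_) ρ → All (m ≢_) w → All (m <_) w
MinInRight⇒<-left min m≤ρ m≢w with m≤y , y≤w , _ ← All.lookupAny m≤ρ min =
  All.zipWith (λ (y≤x , m≢x) → ≤∧≢⇒< (≤-trans m≤y y≤x) m≢x) (y≤w , m≢w)

AndreII-split⁻ : ∀ {w c ρ} → AndreII (w ++ c ∷ ρ) → All (c <_) w → All (c <_) ρ →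
                 (w ≡ [] × ρ ≡ []) ⊎ (AndreII w × AndreII ρ × MinInRight w ρ)
AndreII-split⁻ a = split a refl
  where
  split : ∀ {τ w c ρ} → AndreII τ → τ ≡ w ++ c ∷ ρ → All (c <_) w → All (c <_) ρ →
          (w ≡ [] × ρ ≡ []) ⊎ (AndreII w × AndreII ρ × MinInRight w ρ)
  split {w = []}        (andre-single _) eq _ _ = inj₁ (refl , sym (∷-injectiveʳ eq))
  split {w = _ ∷ []}    (andre-single _) ()
  split {w = _ ∷ _ ∷ _} (andre-single _) ()
  split {w = w} (andre-split {τ} m<τ m<τ′ aτ aτ′ min) eq c<w c<ρ
    with refl , refl ← min-split-unique τ w eq m<τ m<τ′ c<w c<ρ = inj₂ (aτ , aτ′ , min)

data AndreSpine : Word → Set where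
  []    : AndreSpine []
  block : ∀ {w s ρ} → All (s <_) w → All (s <_) ρ → AndreII w → AndreSpine ρ → AndreSpine (w ++ s ∷ ρ)

AndreSpine-∷ʳ : ∀ {u x} → AndreSpine u → All (_< x) u → AndreSpine (u ∷ʳ x)
AndreSpine-∷ʳ [] _ = block [] [] andre-[] []
AndreSpine-∷ʳ {x = x} (block {w} {s} {ρ} s<w s<ρ aw sρ) u<x with _ , s<x , ρ<x ← All-++∷⁻ w u<x =
  subst AndreSpine (sym (++-assoc w (s ∷ ρ) [ x ]))
        (block s<w (All.∷ʳ⁺ s<ρ s<x) aw (AndreSpine-∷ʳ sρ ρ<x))

pushSpine-AndreII : ∀ {c u} → AndreSpine u → All (c <_) u → AndreII (pushSpine c u)
pushSpine-AndreII [] _ = andre-single _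
pushSpine-AndreII {c} (block {w} {s} {ρ} s<w s<ρ aw sρ) c<u
  with c<w , c<s , c<ρ ← All-++∷⁻ w c<u rewrite pushSpine-++ c w s<w s<ρ =
  andre-split c<w (All-pushSpine c<s c<ρ) aw (pushSpine-AndreII sρ s<ρ)
    (lose (∈-pushSpine s ρ) (All.map <⇒≤ s<w , All-pushSpine ≤-refl (All.map <⇒≤ s<ρ)))

pushSpine-HasShape : ∀ {c u T} → HasShape u T → All (c <_) u → HasShape (pushSpine c u) (growSpine T)
pushSpine-HasShape shape-[] _ = shape-node [] [] shape-[] shape-[]
pushSpine-HasShape {c} (shape-node {w} {ρ} {m} m<w m<ρ sw sρ) c<u
  with c<w , c<m , c<ρ ← All-++∷⁻ w c<u rewrite pushSpine-++ c w m<w m<ρ =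
  shape-node c<w (All-pushSpine c<m c<ρ) sw (pushSpine-HasShape sρ m<ρ)

PushSpinePreimage : ℕ → Word → BTree → Set
PushSpinePreimage c τ T = ∃ λ o → pushSpine c o ≡ τ × All (c <_) o × AndreSpine o × HasPrunedShape o T

pushSpine-preimage : ∀ {w c ρ L R} → All (c <_) w → All (c <_) ρ → HasShape w L → HasShape ρ R →
                     AndreII (w ++ c ∷ ρ) → Unique (w ++ c ∷ ρ) →
                     PushSpinePreimage c (w ++ c ∷ ρ) (node L R)
pushSpine-preimage c<w c<ρ sw shape-[] aτ _ with AndreII-split⁻ aτ c<w c<ρ
... | inj₂ (_ , _ , ())
... | inj₁ (refl , _) rewrite HasShape-[]⁻ sw refl = [] , refl , [] , [] , leaf , refl , shape-[]
pushSpine-preimage {w} {c} c<w c<ρ sw (shape-node {w′} {ρ′} {c′} c′<w′ c′<ρ′ sw′ sρ′) aτ uτ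
  with AndreII-split⁻ aτ c<w c<ρ
... | inj₁ (_ , ρ≡[]) with () ← ++-conicalʳ w′ _ ρ≡[]
... | inj₂ (aw , aρ , min)
  with w≢cρ , (_ ∷ uρ) ← AllPairs-++⁻ w uτ
  with o′ , push≡ρ , c′<o′ , spine′ , R′ , R≡ , sR′ ← pushSpine-preimage c′<w′ c′<ρ′ sw′ sρ′ aρ uρ =
  w ++ c′ ∷ o′ ,
  trans (pushSpine-++ c w c′<w c′<o′) (cong (λ v → w ++ c ∷ v) push≡ρ) ,
  All.++⁺ c<w (c<c′ ∷ All.map (<-trans c<c′) c′<o′) ,
  block c′<w c′<o′ aw spine′ ,
  node _ R′ , cong (node _) R≡ , shape-node c′<w c′<o′ sw sR′
  where
  c<c′ : c < c′
  c<c′ = All.head (All.++⁻ʳ w′ c<ρ)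
  c′<w : All (c′ <_) w
  c′<w = MinInRight⇒<-left min (min≤-++∷ w′ c′<w′ c′<ρ′)
           (All.map (λ x≢cρ → ≢-sym (All.lookup x≢cρ (there (∈-++⁺ʳ w′ (here refl))))) w≢cρ)

restrict-++ : ∀ j xs ys → restrict j (xs ++ ys) ≡ restrict j xs ++ restrict j ys
restrict-++ j = filter-++ (_≤? j)

restrict-none : ∀ {j xs} → All (j <_) xs → restrict j xs ≡ []
restrict-none {j} j<xs = filter-none (_≤? j) (All.map <⇒≱ j<xs)

restrict-all : ∀ {j xs} → All (_≤ j) xs → restrict j xs ≡ xs
restrict-all {j} = filter-all (_≤? j)

restrict-accept : ∀ {j x xs} → x ≤ j → restrict j (x ∷ xs) ≡ x ∷ restrict j xs
restrict-accept {j} = filter-accept (_≤? j)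

restrict-reject : ∀ {j x xs} → j < x → restrict j (x ∷ xs) ≡ restrict j xs
restrict-reject {j} j<x = filter-reject (_≤? j) (<⇒≱ j<x)

All-restrict : ∀ j {P : ℕ → Set} {xs} → All P xs → All P (restrict j xs)
All-restrict j = All.filter⁺ (_≤? j)

restrict-++∷ : ∀ j w {s ρ} → s ≤ j → restrict j (w ++ s ∷ ρ) ≡ restrict j w ++ s ∷ restrict j ρ
restrict-++∷ j w {s} {ρ} s≤j =
  trans (restrict-++ j w (s ∷ ρ)) (cong (restrict j w ++_) (restrict-accept s≤j))

restrict-gap : ∀ j w {s ρ} → All (j <_) w → s ≤ j → restrict j (w ++ s ∷ ρ) ≡ s ∷ restrict j ρ
restrict-gap j w j<w s≤j = trans (restrict-++∷ j w s≤j) (cong (_++ _) (restrict-none j<w))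

restrict-++∷-none : ∀ j w {s ρ} → j < s → All (s <_) w → All (s <_) ρ → restrict j (w ++ s ∷ ρ) ≡ []
restrict-++∷-none j w j<s s<w s<ρ =
  restrict-none (All.++⁺ (All.map (<-trans j<s) s<w) (j<s ∷ All.map (<-trans j<s) s<ρ))

NDD-tail : ∀ {x xs} → NoDoubleDescent (x ∷ xs) → NoDoubleDescent xs
NDD-tail {xs = []}        _        = tt
NDD-tail {xs = _ ∷ []}    _        = tt
NDD-tail {xs = _ ∷ _ ∷ _} (_ , nd) = nd

NDD-++⁻ˡ : ∀ xs {ys} → NoDoubleDescent (xs ++ ys) → NoDoubleDescent xs
NDD-++⁻ˡ []               _          = tt
NDD-++⁻ˡ (_ ∷ [])         _          = tt
NDD-++⁻ˡ (_ ∷ _ ∷ [])     _          = tt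
NDD-++⁻ˡ (_ ∷ y ∷ z ∷ xs) (¬dd , nd) = ¬dd , NDD-++⁻ˡ (y ∷ z ∷ xs) nd

NDD-++⁻ʳ : ∀ xs {ys} → NoDoubleDescent (xs ++ ys) → NoDoubleDescent ys
NDD-++⁻ʳ []       nd = nd
NDD-++⁻ʳ (x ∷ xs) nd = NDD-++⁻ʳ xs (NDD-tail nd)

EndsAscending : Word → Set
EndsAscending (x ∷ y ∷ [])    = x < y
EndsAscending (_ ∷ y ∷ z ∷ r) = EndsAscending (y ∷ z ∷ r)
EndsAscending _               = ⊤

EndsAscending-++ : ∀ xs {a b ys} → EndsAscending (a ∷ b ∷ ys) → EndsAscending (xs ++ a ∷ b ∷ ys)
EndsAscending-++ []               e = e
EndsAscending-++ (_ ∷ [])         e = e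
EndsAscending-++ (_ ∷ y ∷ [])     e = e
EndsAscending-++ (_ ∷ y ∷ z ∷ xs) e = EndsAscending-++ (y ∷ z ∷ xs) e

NDD-cons-min : ∀ {s ρ} → NoDoubleDescent ρ → All (s <_) ρ → NoDoubleDescent (s ∷ ρ)
NDD-cons-min {ρ = []}        _  _         = tt
NDD-cons-min {ρ = _ ∷ []}    _  _         = tt
NDD-cons-min {ρ = _ ∷ _ ∷ _} nd (s<y ∷ _) = (λ (s>y , _) → <-asym s<y s>y) , nd

-- Minimality of s excludes a double descent through s, and the final ascent of w one ending at s.
NDD-join : ∀ w {s ρ} → NoDoubleDescent w → EndsAscending w → NoDoubleDescent ρ → All (s <_) ρ →
           NoDoubleDescent (w ++ s ∷ ρ)
NDD-join []              _           _   nd s<ρ = NDD-cons-min nd s<ρ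
NDD-join (_ ∷ [])        {ρ = []}    _ _ _  _   = tt
NDD-join (_ ∷ [])        {ρ = _ ∷ _} _ _ nd s<ρ =
  (λ (_ , s>y) → <-asym (All.head s<ρ) s>y) , NDD-cons-min nd s<ρ
NDD-join (_ ∷ y ∷ [])    _           x<y nd s<ρ =
  (λ (x>y , _) → <-asym x<y x>y) , NDD-join (y ∷ []) tt tt nd s<ρ
NDD-join (_ ∷ y ∷ z ∷ w) (¬dd , ndw) e   nd s<ρ = ¬dd , NDD-join (y ∷ z ∷ w) ndw e nd s<ρ

AndreII⇒EndsAscending : ∀ {w} → AndreII w → EndsAscending w
AndreII⇒EndsAscending andre-[]         = tt
AndreII⇒EndsAscending (andre-single _) = tt
AndreII⇒EndsAscending (andre-split {τ} {_ ∷ []}    _ (m<y ∷ _) _ _  _) = EndsAscending-++ τ m<y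
AndreII⇒EndsAscending (andre-split {τ} {_ ∷ _ ∷ _} _ _         _ aτ′ _) =
  EndsAscending-++ τ (AndreII⇒EndsAscending aτ′)

AndreII⇒NDD : ∀ {w} → AndreII w → NoDoubleDescent w
AndreII⇒NDD andre-[]         = tt
AndreII⇒NDD (andre-single _) = tt
AndreII⇒NDD (andre-split {τ} _ m<τ′ aτ aτ′ _) =
  NDD-join τ (AndreII⇒NDD aτ) (AndreII⇒EndsAscending aτ) (AndreII⇒NDD aτ′) m<τ′

AndreII-restrict : ∀ j {w} → AndreII w → AndreII (restrict j w)
AndreII-restrict j andre-[] = andre-[]
AndreII-restrict j (andre-single x) with x ≤? j
... | yes x≤j rewrite restrict-accept {j} {x} {[]} x≤j        = andre-single x
... | no  x≰j rewrite restrict-reject {j} {x} {[]} (≰⇒> x≰j) = andre-[]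
AndreII-restrict j (andre-split {τ} {τ′} {m} m<τ m<τ′ aτ aτ′ min) with m ≤? j
... | no m≰j rewrite restrict-++∷-none j τ (≰⇒> m≰j) m<τ m<τ′ = andre-[]
... | yes m≤j rewrite restrict-++∷ j τ {m} {τ′} m≤j with Any.filter⁺ (_≤? j) min
...   | inj₁ min′ = andre-split (All-restrict j m<τ) (All-restrict j m<τ′)
                      (AndreII-restrict j aτ) (AndreII-restrict j aτ′)
                      (Any.map (λ (y≤τ , y≤τ′) → All-restrict j y≤τ , All-restrict j y≤τ′) min′)
...   | inj₂ y≰j with y≤τ , y≤τ′ ← Any.lookup-result min
  rewrite restrict-none (All.map (<-≤-trans (≰⇒> y≰j)) y≤τ)
        | restrict-none (All.map (<-≤-trans (≰⇒> y≰j)) y≤τ′) = andre-single m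

AndreSpine-restrict : ∀ j {u} → AndreSpine u → AndreSpine (restrict j u)
AndreSpine-restrict j [] = []
AndreSpine-restrict j (block {w} {s} {ρ} s<w s<ρ aw sρ) with s ≤? j
... | yes s≤j rewrite restrict-++∷ j w {s} {ρ} s≤j =
  block (All-restrict j s<w) (All-restrict j s<ρ)
        (AndreII-restrict j aw) (AndreSpine-restrict j sρ)
... | no s≰j rewrite restrict-++∷-none j w (≰⇒> s≰j) s<w s<ρ = []

AndreSpine⇒NDD : ∀ {u} → AndreSpine u → NoDoubleDescent u
AndreSpine⇒NDD []                      = tt
AndreSpine⇒NDD (block {w} _ s<ρ aw sρ) =
  NDD-join w (AndreII⇒NDD aw) (AndreII⇒EndsAscending aw) (AndreSpine⇒NDD sρ) s<ρ

RestrictionsNDD : Word → Set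
RestrictionsNDD σ = ∀ j → NoDoubleDescent (restrict j σ)

AndreSpine⇒RestrictionsNDD : ∀ {u} → AndreSpine u → RestrictionsNDD u
AndreSpine⇒RestrictionsNDD s j = AndreSpine⇒NDD (AndreSpine-restrict j s)

RestrictionsNDD-++⁻ˡ : ∀ xs {ys} → RestrictionsNDD (xs ++ ys) → RestrictionsNDD xs
RestrictionsNDD-++⁻ˡ xs {ys} nd j =
  NDD-++⁻ˡ (restrict j xs) (subst NoDoubleDescent (restrict-++ j xs ys) (nd j))

RestrictionsNDD-++⁻ʳ : ∀ xs {ys} → RestrictionsNDD (xs ++ ys) → RestrictionsNDD ys
RestrictionsNDD-++⁻ʳ xs {ys} nd j =
  NDD-++⁻ʳ (restrict j xs) (subst NoDoubleDescent (restrict-++ j xs ys) (nd j))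

descent-exposed : ∀ {α m z} xs ys q → All (α <_) xs → All (α <_) ys → m < α → z < m →
                  ¬ RestrictionsNDD (α ∷ xs ++ m ∷ ys ++ z ∷ q)
descent-exposed {α} {m} {z} xs ys q α<xs α<ys m<α z<m nd =
  proj₁ (subst NoDoubleDescent restricted (nd α)) (m<α , z<m)
  where
  restricted : restrict α (α ∷ xs ++ m ∷ ys ++ z ∷ q) ≡ α ∷ m ∷ z ∷ restrict α q
  restricted = trans (restrict-accept ≤-refl) (cong (α ∷_)
    (trans (restrict-gap α xs α<xs (<⇒≤ m<α))
           (cong (m ∷_) (restrict-gap α ys α<ys (<⇒≤ (<-trans z<m m<α))))))

-- For w = a m b: if the least letter α of a were below all of b, deleting the letters above α
-- would leave the double descent α > m > z.
AndreII-from-RestrictionsNDD : ∀ {w L z} → HasShape w L → RestrictionsNDD (w ∷ʳ z) → All (z <_) w →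
                               AndreII w
AndreII-from-RestrictionsNDD shape-[] _ _ = andre-[]
AndreII-from-RestrictionsNDD {z = z} (shape-node {a} {b} {m} m<a m<b sa sb) nd z<w
  with _ , z<m , z<b ← All-++∷⁻ a z<w = join sa sb m<a nd′
  where
  nd′ : RestrictionsNDD (a ++ m ∷ b ∷ʳ z)
  nd′ = subst RestrictionsNDD (++-assoc a (m ∷ b) [ z ]) nd
  nd″ : RestrictionsNDD ((a ∷ʳ m) ++ b ∷ʳ z)
  nd″ = subst RestrictionsNDD (sym (++-assoc a [ m ] (b ∷ʳ z))) nd′
  aa : AndreII a
  aa = AndreII-from-RestrictionsNDD sa (RestrictionsNDD-++⁻ˡ (a ∷ʳ m) nd″) m<a
  ab : AndreII b
  ab = AndreII-from-RestrictionsNDD sb (RestrictionsNDD-++⁻ʳ (a ∷ʳ m) nd″) z<b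
  min-at : ∀ {β} b₁ {b₂} → All (β <_) b₁ → All (β <_) b₂ → All (β ≤_) a →
           MinInRight a (b₁ ++ β ∷ b₂)
  min-at b₁ β<b₁ β<b₂ β≤a = lose (∈-++⁺ʳ b₁ (here refl)) (β≤a , min≤-++∷ b₁ β<b₁ β<b₂)
  exposed : ∀ a₁ {α a₂} → All (α <_) a₂ → All (α <_) b → All (m <_) (a₁ ++ α ∷ a₂) →
            ¬ RestrictionsNDD ((a₁ ++ α ∷ a₂) ++ m ∷ b ∷ʳ z)
  exposed a₁ {α} {a₂} α<a₂ α<b m<a nd =
    descent-exposed a₂ b [] α<a₂ α<b (All.head (All.++⁻ʳ a₁ m<a)) z<m
      (RestrictionsNDD-++⁻ʳ a₁ (subst RestrictionsNDD (++-assoc a₁ (α ∷ a₂) _) nd))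
  join : ∀ {La Lb} → HasShape a La → HasShape b Lb → All (m <_) a →
         RestrictionsNDD (a ++ m ∷ b ∷ʳ z) → AndreII (a ++ m ∷ b)
  join shape-[] shape-[] _ _ = andre-single m
  join shape-[] (shape-node {b₁} β<b₁ β<b₂ _ _) _ _ =
    andre-split m<a m<b aa ab (min-at b₁ β<b₁ β<b₂ [])
  join (shape-node {a₁} α<a₁ α<a₂ _ _) shape-[] m<a nd = ⊥-elim (exposed a₁ α<a₂ [] m<a nd)
  join (shape-node {a₁} {_} {α} α<a₁ α<a₂ _ _) (shape-node {b₁} {_} {β} β<b₁ β<b₂ _ _) m<a nd
    with β ≤? α
  ... | yes β≤α = andre-split m<a m<b aa ab
                    (min-at b₁ β<b₁ β<b₂ (All.map (≤-trans β≤α) (min≤-++∷ a₁ α<a₁ α<a₂)))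
  ... | no  β≰α =
    ⊥-elim (exposed a₁ α<a₂ (All.map (<-≤-trans (≰⇒> β≰α)) (min≤-++∷ b₁ β<b₁ β<b₂)) m<a nd)

AndreSpine-from-RestrictionsNDD : ∀ {u T} → HasShape u T → RestrictionsNDD u → AndreSpine u
AndreSpine-from-RestrictionsNDD shape-[] _ = []
AndreSpine-from-RestrictionsNDD (shape-node {w} {ρ} {s} s<w s<ρ sw sρ) nd =
  block s<w s<ρ (AndreII-from-RestrictionsNDD sw (RestrictionsNDD-++⁻ˡ (w ∷ʳ s) nd′) s<w)
                (AndreSpine-from-RestrictionsNDD sρ (RestrictionsNDD-++⁻ʳ (w ∷ʳ s) nd′))
  where
  nd′ : RestrictionsNDD ((w ∷ʳ s) ++ ρ)
  nd′ = subst RestrictionsNDD (sym (++-assoc w [ s ] ρ)) nd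

simsun⇒RestrictionsNDD : ∀ m {σ} → All (λ x → 0 < x × x ≤ suc m) σ →
                         (∀ k → k < suc m → NoDoubleDescent (restrict (suc m ∸ k) σ)) →
                         RestrictionsNDD σ
simsun⇒RestrictionsNDD m {σ} letters nd zero
  rewrite restrict-none {0} {σ} (All.map proj₁ letters) = tt
simsun⇒RestrictionsNDD m {σ} letters nd (suc i) with suc i ≤? suc m
... | yes j≤n = subst (λ j → NoDoubleDescent (restrict j σ)) (m∸[m∸n]≡n j≤n)
                  (nd (suc m ∸ suc i) (∸-monoʳ-< z<s j≤n))
... | no  j≰n = subst NoDoubleDescent
                  (trans (restrict-all (All.map proj₂ letters)) (sym (restrict-all ≤j)))
                  (nd 0 z<s)
  where
  ≤j : All (_≤ suc i) σ
  ≤j = All.map (λ (_ , x≤n) → ≤-trans x≤n (<⇒≤ (≰⇒> j≰n))) letters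

module Relabel {Q : ℕ → Set} (f : ℕ → ℕ) (f-mono : ∀ {x y} → Q x → Q y → x < y → f x < f y) where

  f-mono≤ : ∀ {x y} → Q x → Q y → x ≤ y → f x ≤ f y
  f-mono≤ qx qy x≤y with m≤n⇒m<n∨m≡n x≤y
  ... | inj₁ x<y  = <⇒≤ (f-mono qx qy x<y)
  ... | inj₂ refl = ≤-refl

  All-map : ∀ {P R : ℕ → Set} → (∀ {x} → Q x → P x → R (f x)) →
            ∀ {w} → All Q w → All P w → All R (map f w)
  All-map g qw pw = All.map⁺ (All.zipWith (λ (q , p) → g q p) (qw , pw))

  All<-map : ∀ {m w} → Q m → All Q w → All (m <_) w → All (f m <_) (map f w)
  All<-map qm = All-map (f-mono qm)

  All≤-map : ∀ {m w} → Q m → All Q w → All (m ≤_) w → All (f m ≤_) (map f w)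
  All≤-map qm = All-map (f-mono≤ qm)

  HasShape-map : ∀ {w T} → All Q w → HasShape w T → HasShape (map f w) T
  HasShape-map _ shape-[] = shape-[]
  HasShape-map q (shape-node {a} {b} {m} m<a m<b sa sb) with qa , qm , qb ← All-++∷⁻ a q =
    subst (λ v → HasShape v _) (sym (map-++ f a (m ∷ b)))
      (shape-node (All<-map qm qa m<a) (All<-map qm qb m<b) (HasShape-map qa sa) (HasShape-map qb sb))

  HasPrunedShape-map : ∀ {w T} → All Q w → HasPrunedShape w T → HasPrunedShape (map f w) T
  HasPrunedShape-map q (T′ , T≡ , s) = T′ , T≡ , HasShape-map q s

  MinInRight-map : ∀ {a b} → All Q a → All Q b → MinInRight a b → MinInRight (map f a) (map f b)
  MinInRight-map qa qb min with y , y∈b , y≤a , y≤b ← find min =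
    lose (∈-map⁺ f y∈b) (All≤-map qy qa y≤a , All≤-map qy qb y≤b)
    where qy = All.lookup qb y∈b

  AndreII-map : ∀ {w} → All Q w → AndreII w → AndreII (map f w)
  AndreII-map _ andre-[]         = andre-[]
  AndreII-map _ (andre-single x) = andre-single (f x)
  AndreII-map q (andre-split {a} {b} {m} m<a m<b aa ab min) with qa , qm , qb ← All-++∷⁻ a q =
    subst AndreII (sym (map-++ f a (m ∷ b)))
      (andre-split (All<-map qm qa m<a) (All<-map qm qb m<b) (AndreII-map qa aa) (AndreII-map qb ab)
        (MinInRight-map qa qb min))

  AndreSpine-map : ∀ {w} → All Q w → AndreSpine w → AndreSpine (map f w)
  AndreSpine-map _ [] = []
  AndreSpine-map q (block {a} {s} {b} s<a s<b aa sb) with qa , qs , qb ← All-++∷⁻ a q =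
    subst AndreSpine (sym (map-++ f a (s ∷ b)))
      (block (All<-map qs qa s<a) (All<-map qs qb s<b) (AndreII-map qa aa) (AndreSpine-map qb sb))

SpineWords : Word → BTree → Set
SpineWords ℓ T = Sub Word (λ u → u ↭ ℓ × AndreSpine u × HasPrunedShape u T)

AndreWords : ℕ → Word → BTree → Set
AndreWords c ℓ T = Sub Word (λ τ → (τ ↭ c ∷ ℓ × AndreII τ) × HasShape τ T)

applyUpTo-suc-bounds : ∀ n → All (λ x → 0 < x × x ≤ n) (applyUpTo suc n)
applyUpTo-suc-bounds n = All.applyUpTo⁺₁ suc n (λ i<n → z<s , i<n)

simsun↔spine : ∀ m T → RS (suc m) T ↔ SpineWords (applyUpTo suc m) T
simsun↔spine m T = Sub-↔ word-≟ word-≟ dropLast (_∷ʳ suc m) to-spine to-simsun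
  (λ ((_ , lastσ , _) , _) → dropLast-∷ʳ-last _ lastσ) (λ _ → dropLast-∷ʳ _ (suc m))
  where
  below : ∀ {u} → u ↭ applyUpTo suc m → All (_< suc m) u
  below u↭ = All.map (λ (_ , x≤m) → s≤s x≤m) (All-resp-↭ (↭-sym u↭) (applyUpTo-suc-bounds m))
  to-spine : ∀ {σ} → Simsun (suc m) σ × HasShape σ T →
             dropLast σ ↭ applyUpTo suc m × AndreSpine (dropLast σ) × HasPrunedShape (dropLast σ) T
  to-spine {σ} ((σ↭ , lastσ , nd) , sσ) = u↭ , spine , pruned
    where
    u = dropLast σ
    σ≡ : u ∷ʳ suc m ≡ σ
    σ≡ = dropLast-∷ʳ-last σ lastσ
    u↭ : u ↭ applyUpTo suc m
    u↭ = ∷ʳ-cancel-↭ (suc m) (subst₂ _↭_ (sym σ≡) (sym (applyUpTo-∷ʳ suc m)) σ↭)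
    ndσ : RestrictionsNDD σ
    ndσ = simsun⇒RestrictionsNDD m (All-resp-↭ (↭-sym σ↭) (applyUpTo-suc-bounds (suc m))) nd
    pruned : HasPrunedShape u T
    pruned = HasShape-∷ʳ⁻ sσ (sym σ≡) (below u↭)
    spine : AndreSpine u
    spine = AndreSpine-from-RestrictionsNDD (proj₂ (proj₂ pruned))
              (RestrictionsNDD-++⁻ˡ u (subst RestrictionsNDD (sym σ≡) ndσ))
  to-simsun : ∀ {u} → u ↭ applyUpTo suc m × AndreSpine u × HasPrunedShape u T →
              Simsun (suc m) (u ∷ʳ suc m) × HasShape (u ∷ʳ suc m) T
  to-simsun {u} (u↭ , spine , T′ , refl , su) =
    (subst (u ∷ʳ suc m ↭_) (applyUpTo-∷ʳ suc m) (++⁺ʳ [ suc m ] u↭) , last-∷ʳ u (suc m) ,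
     λ k _ → AndreSpine⇒RestrictionsNDD (AndreSpine-∷ʳ spine (below u↭)) (suc m ∸ k)) ,
    HasShape-∷ʳ su (below u↭)

module RelabelSuc  = Relabel {λ _ → ⊤} suc (λ _ _ → s<s)
module RelabelPred = Relabel {0 <_} pred (λ 0<x _ → pred-mono-< ⦃ >-nonZero 0<x ⦄)

map-pred-suc : ∀ xs → map pred (map suc xs) ≡ xs
map-pred-suc xs = trans (sym (map-∘ xs)) (map-id xs)

map-suc-pred : ∀ {xs} → All (0 <_) xs → map suc (map pred xs) ≡ xs
map-suc-pred 0<xs = trans (sym (map-∘ _)) (map-id-local (All.map (λ { {suc _} _ → refl }) 0<xs))

spine-map-suc↔ : ∀ ℓ T → SpineWords ℓ T ↔ SpineWords (map suc ℓ) T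
spine-map-suc↔ ℓ T = Sub-↔ word-≟ word-≟ (map suc) (map pred) shift unshift
  (λ _ → map-pred-suc _) (λ (o↭ , _) → map-suc-pred (positive o↭))
  where
  trivial : ∀ w → All (λ _ → ⊤) w
  trivial = All.universal (λ _ → tt)
  positive : ∀ {o} → o ↭ map suc ℓ → All (0 <_) o
  positive o↭ = All-resp-↭ (↭-sym o↭) (All.map⁺ (All.universal (λ _ → z<s) ℓ))
  shift : ∀ {u} → u ↭ ℓ × AndreSpine u × HasPrunedShape u T →
          map suc u ↭ map suc ℓ × AndreSpine (map suc u) × HasPrunedShape (map suc u) T
  shift {u} (u↭ , spine , su) =
    map⁺ suc u↭ ,
    RelabelSuc.AndreSpine-map (trivial u) spine , RelabelSuc.HasPrunedShape-map (trivial u) su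
  unshift : ∀ {o} → o ↭ map suc ℓ × AndreSpine o × HasPrunedShape o T →
            map pred o ↭ ℓ × AndreSpine (map pred o) × HasPrunedShape (map pred o) T
  unshift (o↭ , spine , so) =
    subst (map pred _ ↭_) (map-pred-suc ℓ) (map⁺ pred o↭) ,
    RelabelPred.AndreSpine-map (positive o↭) spine , RelabelPred.HasPrunedShape-map (positive o↭) so

pushSpine-preimage-↭ : ∀ {c ℓ τ T} → All (c <_) ℓ → Unique ℓ → τ ↭ c ∷ ℓ → AndreII τ →
                       HasShape τ T → PushSpinePreimage c τ T
pushSpine-preimage-↭ _ _ τ↭ _ shape-[] with () ← ↭-empty-inv (↭-sym τ↭)
pushSpine-preimage-↭ c<ℓ uℓ τ↭ aτ (shape-node {w} {ρ} {c′} c′<w c′<ρ sw sρ)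
  with refl ← ↭-min-unique w τ↭ c′<w c′<ρ c<ℓ =
  pushSpine-preimage c′<w c′<ρ sw sρ aτ (Unique-resp-↭ (↭-sym τ↭) (All.map <⇒≢ c<ℓ ∷ uℓ))

spine↔andre : ∀ {c ℓ} T → All (c <_) ℓ → Unique ℓ → SpineWords ℓ T ↔ AndreWords c ℓ T
spine↔andre {c} {ℓ} T c<ℓ uℓ = Sub-↔ word-≟ word-≟ (pushSpine c) (proj₁ ∘ popSpine) push pop
  (λ (o↭ , _) → cong proj₁ (popSpine-pushSpine c _ (above o↭))) push∘pop
  where
  above : ∀ {o} → o ↭ ℓ → All (c <_) o
  above o↭ = All-resp-↭ (↭-sym o↭) c<ℓ
  popSpine-preimage : ∀ {o τ} → pushSpine c o ≡ τ → All (c <_) o → proj₁ (popSpine τ) ≡ o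
  popSpine-preimage refl c<o = cong proj₁ (popSpine-pushSpine c _ c<o)
  push : ∀ {o} → o ↭ ℓ × AndreSpine o × HasPrunedShape o T →
         (pushSpine c o ↭ c ∷ ℓ × AndreII (pushSpine c o)) × HasShape (pushSpine c o) T
  push {o} (o↭ , spine , T′ , refl , so) =
    (↭-trans (pushSpine-↭ c o) (↭-prep c o↭) , pushSpine-AndreII spine (above o↭)) ,
    pushSpine-HasShape so (above o↭)
  push∘pop : ∀ {τ} → (τ ↭ c ∷ ℓ × AndreII τ) × HasShape τ T →
             pushSpine c (proj₁ (popSpine τ)) ≡ τ
  push∘pop ((τ↭ , aτ) , sτ) with o , push≡ , c<o , _ ← pushSpine-preimage-↭ c<ℓ uℓ τ↭ aτ sτ =
    trans (cong (pushSpine c) (popSpine-preimage push≡ c<o)) push≡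
  pop : ∀ {τ} → (τ ↭ c ∷ ℓ × AndreII τ) × HasShape τ T →
        let o = proj₁ (popSpine τ) in o ↭ ℓ × AndreSpine o × HasPrunedShape o T
  pop ((τ↭ , aτ) , sτ) with o , push≡ , c<o , spine , so ← pushSpine-preimage-↭ c<ℓ uℓ τ↭ aτ sτ
    rewrite popSpine-preimage push≡ c<o =
    drop-∷ (↭-trans (↭-sym (pushSpine-↭ c o)) (subst (_↭ c ∷ ℓ) (sym push≡) τ↭)) , spine , so

-- AndII (suc m) T unfolds to AndreWords 1 (applyUpTo (suc ∘ suc) m) T.
theorem4p1 : (n : ℕ) → n ≥ 1 → (T : BTree) → URL n T → RS n T ⤖ AndII n T
theorem4p1 (suc m) _ T _ =
  ↔⇒⤖ (↔-trans (simsun↔spine m T) (↔-trans shift (spine↔andre T 1<letters unique-letters)))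
  where
  shift : SpineWords (applyUpTo suc m) T ↔ SpineWords (applyUpTo (suc ∘ suc) m) T
  shift = subst (λ ℓ → SpineWords (applyUpTo suc m) T ↔ SpineWords ℓ T)
                (map-applyUpTo suc suc m) (spine-map-suc↔ (applyUpTo suc m) T)
  1<letters : All (1 <_) (applyUpTo (suc ∘ suc) m)
  1<letters = All.applyUpTo⁺₂ (suc ∘ suc) m (λ _ → s<s z<s)
  unique-letters : Unique (applyUpTo (suc ∘ suc) m)
  unique-letters = Unique.applyUpTo⁺₁ (suc ∘ suc) m (λ i<j _ → <⇒≢ (s<s (s<s i<j)))
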